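{- Let $P$ be a named $\mathrm{GS4}$ derivation with conclusion $\vdash\Gamma$. For every edge $xy\in E_{\langle\!\langle P\rangle\!\rangle}$ we have $\Gamma[x]=\overline{\Gamma[y]}$.
   Context: Named formulas and sequents. Fix a countably infinite set $\mathcal N$ of names and a set $\mathcal A$ of atoms with a fixpoint-free involution $\alpha\mapsto\bar\alpha$. Named formulas: $A,B::=\alpha^x\mid A\lor B\mid A\land B$ ($\alpha\in\mathcal A$, $x\in\mathcal N$); formulas $\alpha^x$ are atomic. Negation: $\overline{\alpha^x}=\bar\alpha^x$, $\overline{A\lor B}=\bar A\land\bar B$, $\overline{A\land B}=\bar A\lor\bar B$ (names preserved). $\mathrm{names}(A)$ is the set of names in $A$, $\mathrm{names}(\Gamma)=\bigcup_{A\in\Gamma}\mathrm{names}(A)$. $A\equiv B$ means $A,B$ coincide after erasing names. A formula is sharing-free if each name occurs in it at most once; a set is sharing-free if its members are sharing-free with pairwise disjoint name sets. A sequent $\vdash\Gamma$ is a finite sharing-free set $\Gamma$; in comma notation the components have pairwise disjoint name sets and $\Gamma,A=\Gamma\cup\{A\}$. For sharing-free $\Gamma$ and $x\in\mathrm{names}(\Gamma)$, $\Gamma[x]$ is the unique atom $\alpha$ such that $\alpha^x$ is a subformula of a member of $\Gamma$. Derivations. Named $\mathrm{GS4}$ derivations are finite trees of rule applications labelled with sharing-free sequents: axiom $\mathrm{ax}_{\{A,\bar B\}}$ (no premisses, conclusion $\vdash\Gamma,A,\bar B$, $A\equiv B$); cut (premisses $\vdash\Gamma,A$, $\vdash\Gamma,\bar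 A$, conclusion $\vdash\Gamma$); superposition $\sqcup$ (premisses $\vdash\Gamma$, $\vdash\Gamma$, conclusion $\vdash\Gamma$); $\lor$ (premiss $\vdash\Gamma,A,B$, conclusion $\vdash\Gamma,A\lor B$); $\land$ (premisses $\vdash\Gamma,A$, $\vdash\Gamma,B$, conclusion $\vdash\Gamma,A\land B$). Branches. $\mathrm{Br}(\alpha^x)=\{\{x\}\}$, $\mathrm{Br}(B\lor C)=\{X\cup Y\mid X\in\mathrm{Br}(B),Y\in\mathrm{Br}(C)\}$, $\mathrm{Br}(B\land C)=\mathrm{Br}(B)\cup\mathrm{Br}(C)$; for sharing-free $\Gamma$, $\mathrm{Br}(\Gamma)=\{X\subseteq\mathrm{names}(\Gamma)\mid\forall A\in\Gamma,\ X\cap\mathrm{names}(A)\in\mathrm{Br}(A)\}$. Branch-labeled graphs. A bl-graph is $G=\langle V_G,\triangleleft_G\rangle$ with $V_G\subseteq\mathcal N$ and $\triangleleft_G$ a relation between 2-element subsets $e$ of $V_G$ and subsets $X\subseteq V_G$ such that $e\triangleleft_G X$ implies $e\subseteq X$; its edges are $E_G=\{e\mid\exists X.\,e\triangleleft_G X\}$. Union $\sqcup$ is componentwise union. For $I\subseteq\mathcal N$: $e\triangleleft^I_G X$ iff $e\triangleleft_G Y$ for some $Y$ with $X=Y\setminus I$. An alternating $X$-labeled path between bl-graphs $G,H$ through $I$ is a sequence $x_1,\dots,x_n$ ($n>1$) of pairwise distinct vertices of $G$ or $H$ with $x_i\in I$ for $1<i<n$ such that either $x_ix_{i+1}\triangleleft^I_G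 X$ for all odd $i$ and $x_ix_{i+1}\triangleleft^I_H X$ for all even $i$, or the same with $G,H$ swapped; it is complete if $x_1,x_n\notin I$. $G\odot_I H$ has vertex set $V=(V_G\cup V_H)\setminus I$ and, for $x\ne y\in V$, $X\subseteq V$, $xy\triangleleft X$ iff there is a complete alternating $X$-labeled path from $x$ to $y$ between $G$ and $H$ through $I$; $\odot_A=\odot_{\mathrm{names}(A)}$. $\mathrm{wk}_\Gamma(G)=\langle V_G\cup\mathrm{names}(\Gamma),\{(e,X\cup Y)\mid e\triangleleft_G X,\,Y\in\mathrm{Br}(\Gamma)\}\rangle$. $\mathrm{id}_{\{\alpha^x,\bar\alpha^y\}}=\langle\{x,y\},\{(xy,\{x,y\})\}\rangle$, and for disjoint sharing-free $A_1\lor A_2$, $\bar B_1\land\bar B_2$ with $A_i\equiv B_i$, $\mathrm{id}_{\{A_1\lor A_2,\bar B_1\land\bar B_2\}}=\mathrm{wk}_{\{A_2\}}(\mathrm{id}_{\{A_1,\bar B_1\}})\sqcup\mathrm{wk}_{\{A_1\}}(\mathrm{id}_{\{A_2,\bar B_2\}})$ (every axiom pair of non-atomic formulas is an unordered pair of this shape). $\langle\!\langle P\rangle\!\rangle$ is $\mathrm{wk}_\Gamma(\mathrm{id}_{\{A,\bar B\}})$ for an axiom $\mathrm{ax}_{\{A,\bar B\}}$ with conclusion $\vdash\Gamma,A,\bar B$; $\langle\!\langle Q\rangle\!\rangle\odot_A\langle\!\langle R\rangle\!\rangle$ for a cut with premiss derivations $Q$ of $\vdash\Gamma,A$, $R$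 of $\vdash\Gamma,\bar A$; the union of the premisses' bl-graphs for $\sqcup,\lor,\land$. -}

module Defs where

open import Level using (Level; 0ℓ; Lift) renaming (suc to lsuc)
open import Data.Nat using (ℕ)
open import Data.Bool using (Bool; true; false; not)
open import Data.Empty using (⊥)
open import Data.Product using (Σ; _×_; _,_)
open import Data.Sum using (_⊎_)
open import Data.List using (List; []; _∷_; _++_; concatMap; [_])
open import Data.List.Relation.Unary.All using (All)
open import Data.List.Relation.Unary.Any using (Any)
open import Data.List.Relation.Unary.Unique.Propositional using (Unique)
open import Data.List.Relation.Binary.Permutation.Propositional using (_↭_)
import Data.List.Membership.Propositional as LM
open import Relation.Nullary using (¬_)
open import Relation.Binary.PropositionalEquality using (_≡_; _≢_)
open import Relation.Unary using (Pred; _⊆_; _≐_; _∪_; _∖_; ｛_｝)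

record AtomSet : Set₁ where
  field
    Atom       : Set
    bar        : Atom → Atom
    bar-invol  : ∀ a → bar (bar a) ≡ a
    bar-fpfree : ∀ a → bar a ≢ a

module GS4 (𝔸 : AtomSet) where
  open AtomSet 𝔸 public

  Name : Set
  Name = ℕ

  infixr 6 _∨_
  infixr 7 _∧_
  data Fm : Set where
    at  : Atom → Name → Fm
    _∨_ : Fm → Fm → Fm
    _∧_ : Fm → Fm → Fm

  neg : Fm → Fm
  neg (at a x) = at (bar a) x
  neg (A ∨ B)  = neg A ∧ neg B
  neg (A ∧ B)  = neg A ∨ neg B

  -- Formulas with names erased; A ≡ B in the paper is  erase A ≡ erase B.
  data Shape : Set where
    sat  : Atom → Shape
    _∨s_ : Shape → Shape → Shape
    _∧s_ : Shape → Shape → Shape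

  erase : Fm → Shape
  erase (at a x) = sat a
  erase (A ∨ B)  = erase A ∨s erase B
  erase (A ∧ B)  = erase A ∧s erase B

  namesL : Fm → List Name
  namesL (at a x) = x ∷ []
  namesL (A ∨ B)  = namesL A ++ namesL B
  namesL (A ∧ B)  = namesL A ++ namesL B

  Sub : Set₁
  Sub = Pred Name 0ℓ

  names : Fm → Sub
  names A z = z LM.∈ namesL A

  namesΓ : List Fm → Sub
  namesΓ Γ z = Any (λ A → names A z) Γ

  -- A finite set of formulas is represented by a list; a sharing-free list
  -- (every name occurs at most once overall) has no repeated formulas and its
  -- members have pairwise disjoint name sets.
  SharingFree : List Fm → Set
  SharingFree Γ = Unique (concatMap namesL Γ)

  data _⊑_ : Fm → Fm → Set where
    ⊑-refl : ∀ {A} → A ⊑ A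
    ⊑-∨l   : ∀ {A B C} → A ⊑ B → A ⊑ (B ∨ C)
    ⊑-∨r   : ∀ {A B C} → A ⊑ C → A ⊑ (B ∨ C)
    ⊑-∧l   : ∀ {A B C} → A ⊑ B → A ⊑ (B ∧ C)
    ⊑-∧r   : ∀ {A B C} → A ⊑ C → A ⊑ (B ∧ C)

  -- AtomAt Γ x α : α^x is a subformula of a member of Γ  (i.e. Γ[x] = α)
  AtomAt : List Fm → Name → Atom → Set
  AtomAt Γ x α = Any (λ A → at α x ⊑ A) Γ

  -- Branches: BrF A X  means  X ∈ Br(A)
  data BrF : Fm → Sub → Set₁ where
    br-at  : ∀ {a x X} → X ≐ ｛ x ｝ → BrF (at a x) X
    br-∨   : ∀ {B C X Y Z} → BrF B Y → BrF C Z → X ≐ (Y ∪ Z) → BrF (B ∨ C) X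
    br-∧l  : ∀ {B C X} → BrF B X → BrF (B ∧ C) X
    br-∧r  : ∀ {B C X} → BrF C X → BrF (B ∧ C) X

  BrΓ : List Fm → Sub → Set₁
  BrΓ Γ X = (X ⊆ namesΓ Γ) × All (λ A → BrF A (λ z → X z × names A z)) Γ

  -- Branch-labelled graphs.  R x y X  means  {x,y} ◁ X  (kept symmetric).
  record BLG : Set₂ where
    field
      V : Sub
      R : Name → Name → Sub → Set₁
  open BLG public

  emptyG : BLG
  emptyG = record { V = λ _ → ⊥ ; R = λ _ _ _ → Lift (lsuc 0ℓ) ⊥ }

  _⊔_ : BLG → BLG → BLG
  G ⊔ H = record { V = V G ∪ V H ; R = λ x y X → R G x y X ⊎ R H x y X }

  wk : List Fm → BLG → BLG
  wk Γ G = record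
    { V = V G ∪ namesΓ Γ
    ; R = λ x y X → Σ Sub λ Y → Σ Sub λ Z → R G x y Y × BrΓ Γ Z × (X ≐ (Y ∪ Z)) }

  pairS : Name → Name → Sub
  pairS x y z = z ≡ x ⊎ z ≡ y

  idAt : Name → Name → BLG
  idAt x y = record
    { V = pairS x y
    ; R = λ u v X → Lift (lsuc 0ℓ) ((((u ≡ x) × (v ≡ y)) ⊎ ((u ≡ y) × (v ≡ x))) × (X ≐ pairS x y)) }

  -- idPair A C = id_{A,C} for an axiom pair {A, C} with C = B̄, A ≡ B.
  -- (The fallback clause is never used for genuine axiom pairs.)
  idPair : Fm → Fm → BLG
  idPair (at a x) (at b y)   = idAt x y
  idPair (A₁ ∨ A₂) (D₁ ∧ D₂) = wk [ A₂ ] (idPair A₁ D₁) ⊔ wk [ A₁ ] (idPair A₂ D₂)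
  idPair (D₁ ∧ D₂) (A₁ ∨ A₂) = wk [ A₂ ] (idPair A₁ D₁) ⊔ wk [ A₁ ] (idPair A₂ D₂)
  idPair _ _                 = emptyG

  LabI : BLG → Sub → Name → Name → Sub → Set₁
  LabI G I x y X = Σ Sub λ Y → R G x y Y × (X ≐ (Y ∖ I))

  if' : Bool → BLG → BLG → BLG
  if' true  G H = G
  if' false G H = H

  -- alternating X-labelled steps; Bool says which graph (true = G) is used first
  data Alt (G H : BLG) (I X : Sub) : Bool → List Name → Set₁ where
    alt-one  : ∀ {b x y} → LabI (if' b G H) I x y X → Alt G H I X b (x ∷ y ∷ [])
    alt-step : ∀ {b x y rest} → LabI (if' b G H) I x y X →
               Alt G H I X (not b) (y ∷ rest) → Alt G H I X b (x ∷ y ∷ rest)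

  CompletePath : BLG → BLG → Sub → Sub → Name → Name → Set₁
  CompletePath G H I X x y = Σ (List Name) λ mid →
    let xs = x ∷ mid ++ y ∷ [] in
    Unique xs × All (λ v → V G v ⊎ V H v) xs × All I mid × ¬ I x × ¬ I y ×
    (Alt G H I X true xs ⊎ Alt G H I X false xs)

  compose : BLG → Sub → BLG → BLG
  compose G I H = record
    { V = Vc
    ; R = λ x y X → (x ≢ y) × Vc x × Vc y × (X ⊆ Vc) × CompletePath G H I X x y }
    where
    Vc : Sub
    Vc z = (V G z ⊎ V H z) × ¬ I z

  -- Named GS4 derivations, indexed by their conclusion (a list standing for a set;
  -- exchange is absorbed by allowing any permutation Δ of the displayed sequent).
  data Deriv : List Fm → Set where
    ax  : ∀ {Δ} (Γ : List Fm) (A B : Fm) → erase A ≡ erase B →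
          SharingFree Δ → Δ ↭ (A ∷ neg B ∷ Γ) → Deriv Δ
    cut : ∀ {Δ} (Γ : List Fm) (A : Fm) → Deriv (A ∷ Γ) → Deriv (neg A ∷ Γ) →
          SharingFree Δ → Δ ↭ Γ → Deriv Δ
    sup : ∀ {Γ} → Deriv Γ → Deriv Γ → SharingFree Γ → Deriv Γ
    or  : ∀ {Δ} (Γ : List Fm) (A B : Fm) → Deriv (A ∷ B ∷ Γ) →
          SharingFree Δ → Δ ↭ ((A ∨ B) ∷ Γ) → Deriv Δ
    and : ∀ {Δ} (Γ : List Fm) (A B : Fm) → Deriv (A ∷ Γ) → Deriv (B ∷ Γ) →
          SharingFree Δ → Δ ↭ ((A ∧ B) ∷ Γ) → Deriv Δ

  ⟪_⟫ : ∀ {Δ} → Deriv Δ → BLG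
  ⟪ ax Γ A B _ _ _ ⟫      = wk Γ (idPair A (neg B))
  ⟪ cut Γ A Q R _ _ ⟫     = compose ⟪ Q ⟫ (names A) ⟪ R ⟫
  ⟪ sup Q R _ ⟫           = ⟪ Q ⟫ ⊔ ⟪ R ⟫
  ⟪ or Γ A B Q _ _ ⟫      = ⟪ Q ⟫
  ⟪ and Γ A B Q R _ _ ⟫   = ⟪ Q ⟫ ⊔ ⟪ R ⟫

  Edge : BLG → Name → Name → Set₁
  Edge G x y = Σ Sub λ X → R G x y X

-- Axiom edges join the two occurrences of an
-- atom in a pair A, B̄ with A ≡ B, so they are complementary; rules other than
-- cut only enlarge formulas, which keeps every atom occurrence.  An edge of a
-- cut composite comes from an alternating path x, m₁, …, mₖ, y whose steps are
-- edges of the two premiss graphs: each step flips the atom, and crossing at an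
-- inner vertex mᵢ ∈ names(A) from the premiss with A to the one with Ā flips
-- it back, because sharing-freeness makes mᵢ name one atom in A and its
-- negation in Ā.
module Submission where

open import Defs
open import Data.Bool using (Bool; true; false; not)
open import Data.Empty using (⊥-elim)
open import Data.List using (List; []; _∷_; _++_; [_]; map; concatMap)
open import Data.List.Properties using (map-++; map-concatMap; concatMap-cong; ∷-injectiveʳ; ++-conicalʳ)
open import Data.List.Membership.Propositional using (_∈_)
open import Data.List.Membership.Propositional.Properties using (∈-++⁺ˡ; ∈-++⁺ʳ; ∈-++⁻; ∈-map⁺)
open import Data.List.Relation.Unary.All using (All; _∷_; lookup)
open import Data.List.Relation.Unary.AllPairs using (AllPairs; _∷_)
import Data.List.Relation.Unary.AllPairs.Properties as AllPairs
open import Data.List.Relation.Unary.Any using (here; there)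
import Data.List.Relation.Unary.Any as Any
import Data.List.Relation.Unary.Any.Properties as Anyₚ
open import Data.List.Relation.Binary.Permutation.Propositional using (_↭_; ↭-sym; ↭-refl; swap)
open import Data.List.Relation.Binary.Permutation.Propositional.Properties using (Any-resp-↭)
open import Data.Product using (Σ; ∃; _×_; _,_; proj₁)
open import Data.Sum using (inj₁; inj₂)
open import Function using (_on_; _∘_; id)
open import Level using (lift)
open import Relation.Nullary using (¬_)
open import Relation.Binary.PropositionalEquality using (_≡_; _≢_; refl; sym; trans; cong; cong₂; subst)

keys-functional : ∀ {K V : Set} {L : List (K × V)} {k : K} {a b : V} →
                  AllPairs (_≢_ on proj₁) L → (k , a) ∈ L → (k , b) ∈ L → a ≡ b
keys-functional _        (here refl) (here refl) = refl
keys-functional (k∉ ∷ _) (here refl) (there m)   = ⊥-elim (lookup k∉ m refl)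
keys-functional (k∉ ∷ _) (there m)   (here refl) = ⊥-elim (lookup k∉ m refl)
keys-functional (_ ∷ u)  (there m)   (there n)   = keys-functional u m n

module _ (𝔸 : AtomSet) where
  open GS4 𝔸

  bar-swap : ∀ {α β} → α ≡ bar β → β ≡ bar α
  bar-swap {α} {β} e = trans (sym (bar-invol β)) (cong bar (sym e))

  namesL-neg : ∀ C → namesL (neg C) ≡ namesL C
  namesL-neg (at a x) = refl
  namesL-neg (B ∨ C)  = cong₂ _++_ (namesL-neg B) (namesL-neg C)
  namesL-neg (B ∧ C)  = cong₂ _++_ (namesL-neg B) (namesL-neg C)

  ⊑-neg : ∀ {α x C} → at α x ⊑ C → at (bar α) x ⊑ neg C
  ⊑-neg ⊑-refl   = ⊑-refl
  ⊑-neg (⊑-∨l p) = ⊑-∧l (⊑-neg p)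
  ⊑-neg (⊑-∨r p) = ⊑-∧r (⊑-neg p)
  ⊑-neg (⊑-∧l p) = ⊑-∨l (⊑-neg p)
  ⊑-neg (⊑-∧r p) = ⊑-∨r (⊑-neg p)

  ⊑-neg⁻ : ∀ {α x} C → at α x ⊑ neg C → at (bar α) x ⊑ C
  ⊑-neg⁻ (at a x) ⊑-refl   = subst (λ t → at t x ⊑ at a x) (sym (bar-invol a)) ⊑-refl
  ⊑-neg⁻ (B ∨ C)  (⊑-∧l p) = ⊑-∨l (⊑-neg⁻ B p)
  ⊑-neg⁻ (B ∨ C)  (⊑-∧r p) = ⊑-∨r (⊑-neg⁻ C p)
  ⊑-neg⁻ (B ∧ C)  (⊑-∨l p) = ⊑-∧l (⊑-neg⁻ B p)
  ⊑-neg⁻ (B ∧ C)  (⊑-∨r p) = ⊑-∧r (⊑-neg⁻ C p)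

  occurrences : Fm → List (Name × Atom)
  occurrences (at a x) = [ x , a ]
  occurrences (B ∨ C)  = occurrences B ++ occurrences C
  occurrences (B ∧ C)  = occurrences B ++ occurrences C

  map-proj₁-occurrences : ∀ C → map proj₁ (occurrences C) ≡ namesL C
  map-proj₁-occurrences (at a x) = refl
  map-proj₁-occurrences (B ∨ C)  =
    trans (map-++ proj₁ (occurrences B) (occurrences C))
          (cong₂ _++_ (map-proj₁-occurrences B) (map-proj₁-occurrences C))
  map-proj₁-occurrences (B ∧ C)  =
    trans (map-++ proj₁ (occurrences B) (occurrences C))
          (cong₂ _++_ (map-proj₁-occurrences B) (map-proj₁-occurrences C))

  ⊑⇒∈-occurrences : ∀ {α x C} → at α x ⊑ C → (x , α) ∈ occurrences C
  ⊑⇒∈-occurrences ⊑-refl           = here refl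
  ⊑⇒∈-occurrences (⊑-∨l p)         = ∈-++⁺ˡ (⊑⇒∈-occurrences p)
  ⊑⇒∈-occurrences (⊑-∨r {B = B} p) = ∈-++⁺ʳ (occurrences B) (⊑⇒∈-occurrences p)
  ⊑⇒∈-occurrences (⊑-∧l p)         = ∈-++⁺ˡ (⊑⇒∈-occurrences p)
  ⊑⇒∈-occurrences (⊑-∧r {B = B} p) = ∈-++⁺ʳ (occurrences B) (⊑⇒∈-occurrences p)

  ⊑⇒∈-namesL : ∀ {α x C} → at α x ⊑ C → x ∈ namesL C
  ⊑⇒∈-namesL {C = C} p =
    subst (_ ∈_) (map-proj₁-occurrences C) (∈-map⁺ proj₁ (⊑⇒∈-occurrences p))

  ∈-namesL⇒⊑ : ∀ {x} C → x ∈ namesL C → ∃ λ α → at α x ⊑ C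
  ∈-namesL⇒⊑ (at a z) (here refl) = a , ⊑-refl
  ∈-namesL⇒⊑ (B ∨ C) m with ∈-++⁻ (namesL B) m
  ... | inj₁ p = let α , q = ∈-namesL⇒⊑ B p in α , ⊑-∨l q
  ... | inj₂ p = let α , q = ∈-namesL⇒⊑ C p in α , ⊑-∨r q
  ∈-namesL⇒⊑ (B ∧ C) m with ∈-++⁻ (namesL B) m
  ... | inj₁ p = let α , q = ∈-namesL⇒⊑ B p in α , ⊑-∧l q
  ... | inj₂ p = let α , q = ∈-namesL⇒⊑ C p in α , ⊑-∧r q

  AtomAt-functional : ∀ {Δ x α β} → SharingFree Δ → AtomAt Δ x α → AtomAt Δ x β → α ≡ β
  AtomAt-functional {Δ} sf p q = keys-functional keys-distinct (∈-occurrences p) (∈-occurrences q)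
    where
    names-occurrences : map proj₁ (concatMap occurrences Δ) ≡ concatMap namesL Δ
    names-occurrences = trans (map-concatMap proj₁ occurrences Δ)
                              (concatMap-cong map-proj₁-occurrences Δ)
    keys-distinct : AllPairs (_≢_ on proj₁) (concatMap occurrences Δ)
    keys-distinct = AllPairs.map⁻ (subst (AllPairs _≢_) (sym names-occurrences) sf)
    ∈-occurrences : ∀ {x γ} → AtomAt Δ x γ → (x , γ) ∈ concatMap occurrences Δ
    ∈-occurrences r = Anyₚ.concatMap⁺ occurrences (Any.map ⊑⇒∈-occurrences r)

  AtomAt-tail : ∀ {C Γ x α} → ¬ x ∈ namesL C → AtomAt (C ∷ Γ) x α → AtomAt Γ x α
  AtomAt-tail x∉ (here p)  = ⊥-elim (x∉ (⊑⇒∈-namesL p))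
  AtomAt-tail x∉ (there p) = p

  infix 4 _≼_
  _≼_ : List Fm → List Fm → Set
  Γ ≼ Δ = ∀ {z γ} → AtomAt Γ z γ → AtomAt Δ z γ

  ↭⇒≼ : ∀ {Γ Δ} → Δ ↭ Γ → Γ ≼ Δ
  ↭⇒≼ π = Any-resp-↭ (↭-sym π)

  ∷⁺ : ∀ {A C Γ Δ} → (∀ {z γ} → at γ z ⊑ A → at γ z ⊑ C) → Γ ≼ Δ → A ∷ Γ ≼ C ∷ Δ
  ∷⁺ f g (here p)  = here (f p)
  ∷⁺ f g (there p) = there (g p)

  ∨-≼ : ∀ {A B Γ} → A ∷ B ∷ Γ ≼ (A ∨ B) ∷ Γ
  ∨-≼ (here p)          = here (⊑-∨l p)
  ∨-≼ (there (here p))  = here (⊑-∨r p)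
  ∨-≼ (there (there p)) = there p

  DualAt : List Fm → Name → Name → Set
  DualAt Γ x y = ∃ λ α → AtomAt Γ x α × AtomAt Γ y (bar α)

  DualAt-map : ∀ {Γ Δ x y} → Γ ≼ Δ → DualAt Γ x y → DualAt Δ x y
  DualAt-map f (α , p , q) = α , f p , f q

  DualAt-sym : ∀ {Γ x y} → DualAt Γ x y → DualAt Γ y x
  DualAt-sym {Γ} {x} (α , p , q) = bar α , q , subst (AtomAt Γ x) (sym (bar-invol α)) p

  DualAt-step : ∀ {Δ u v γ} → SharingFree Δ → DualAt Δ u v → AtomAt Δ u γ → AtomAt Δ v (bar γ)
  DualAt-step {Δ} {v = v} sf (α , p , q) r =
    subst (λ t → AtomAt Δ v (bar t)) (AtomAt-functional sf p r) q

  -- An axiom pair {C, E}; in ∧∨ the ∨-side components come first, as in idPair.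
  data Complementary : Fm → Fm → Set where
    atomic : ∀ {a b x y} → b ≡ bar a → Complementary (at a x) (at b y)
    ∨∧     : ∀ {A₁ A₂ D₁ D₂} → Complementary A₁ D₁ → Complementary A₂ D₂ →
             Complementary (A₁ ∨ A₂) (D₁ ∧ D₂)
    ∧∨     : ∀ {A₁ A₂ D₁ D₂} → Complementary A₁ D₁ → Complementary A₂ D₂ →
             Complementary (D₁ ∧ D₂) (A₁ ∨ A₂)

  Complementary-sym : ∀ {C E} → Complementary C E → Complementary E C
  Complementary-sym (atomic e) = atomic (bar-swap e)
  Complementary-sym (∨∧ p q)   = ∧∨ p q
  Complementary-sym (∧∨ p q)   = ∨∧ p q

  erase-complementary : ∀ A B → erase A ≡ erase B → Complementary A (neg B)
  erase-complementary (at a x)  (at .a y) refl = atomic refl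
  erase-complementary (A₁ ∨ A₂) (B₁ ∨ B₂) e    =
    let e₁ , e₂ = ∨s-injective e in
    ∨∧ (erase-complementary A₁ B₁ e₁) (erase-complementary A₂ B₂ e₂)
    where
    ∨s-injective : ∀ {s t s′ t′} → s ∨s t ≡ s′ ∨s t′ → s ≡ s′ × t ≡ t′
    ∨s-injective refl = refl , refl
  erase-complementary (A₁ ∧ A₂) (B₁ ∧ B₂) e    =
    let e₁ , e₂ = ∧s-injective e in
    ∧∨ (Complementary-sym (erase-complementary A₁ B₁ e₁))
       (Complementary-sym (erase-complementary A₂ B₂ e₂))
    where
    ∧s-injective : ∀ {s t s′ t′} → s ∧s t ≡ s′ ∧s t′ → s ≡ s′ × t ≡ t′
    ∧s-injective refl = refl , refl
  erase-complementary (at _ _)  (_ ∨ _)  ()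
  erase-complementary (at _ _)  (_ ∧ _)  ()
  erase-complementary (_ ∨ _)   (at _ _) ()
  erase-complementary (_ ∨ _)   (_ ∧ _)  ()
  erase-complementary (_ ∧ _)   (at _ _) ()
  erase-complementary (_ ∧ _)   (_ ∨ _)  ()

  idPair-edge-dual : ∀ {C E x y} → Complementary C E → Edge (idPair C E) x y →
                     DualAt (C ∷ E ∷ []) x y
  idPair-edge-dual (atomic refl) (_ , lift (inj₁ (refl , refl) , _)) =
    _ , here ⊑-refl , there (here ⊑-refl)
  idPair-edge-dual (atomic refl) (_ , lift (inj₂ (refl , refl) , _)) =
    DualAt-sym (_ , here ⊑-refl , there (here ⊑-refl))
  idPair-edge-dual (∨∧ p q) (_ , inj₁ (Y , _ , r , _)) =
    DualAt-map (∷⁺ ⊑-∨l (∷⁺ ⊑-∧l λ ())) (idPair-edge-dual p (Y , r))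
  idPair-edge-dual (∨∧ p q) (_ , inj₂ (Y , _ , r , _)) =
    DualAt-map (∷⁺ ⊑-∨r (∷⁺ ⊑-∧r λ ())) (idPair-edge-dual q (Y , r))
  idPair-edge-dual (∧∨ p q) (_ , inj₁ (Y , _ , r , _)) =
    DualAt-map (↭⇒≼ (swap _ _ ↭-refl) ∘ ∷⁺ ⊑-∨l (∷⁺ ⊑-∧l λ ()))
               (idPair-edge-dual p (Y , r))
  idPair-edge-dual (∧∨ p q) (_ , inj₂ (Y , _ , r , _)) =
    DualAt-map (↭⇒≼ (swap _ _ ↭-refl) ∘ ∷⁺ ⊑-∨r (∷⁺ ⊑-∧r λ ()))
               (idPair-edge-dual q (Y , r))

  side : Bool → Fm → Fm
  side true  A = A
  side false A = neg A

  namesL-side : ∀ b A → namesL (side b A) ≡ namesL A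
  namesL-side true  A = refl
  namesL-side false A = namesL-neg A

  ⊑-side-flip : ∀ b {A α x} → at α x ⊑ side b A → at (bar α) x ⊑ side (not b) A
  ⊑-side-flip true      = ⊑-neg
  ⊑-side-flip false {A} = ⊑-neg⁻ A

  Alt-head-edge : ∀ {G H I X b x zs} → Alt G H I X b (x ∷ zs) → ∃ λ v → Edge (if' b G H) x v
  Alt-head-edge (alt-one  (Y , r , _))   = _ , Y , r
  Alt-head-edge (alt-step (Y , r , _) _) = _ , Y , r

  module CutPath {A : Fm} {Γ : List Fm} {G H : BLG}
    (sf   : ∀ b → SharingFree (side b A ∷ Γ))
    (dual : ∀ b {u v} → Edge (if' b G H) u v → DualAt (side b A ∷ Γ) u v) where

    tail-side : ∀ b {z γ} → ¬ z ∈ namesL A → AtomAt (side b A ∷ Γ) z γ → AtomAt Γ z γ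
    tail-side b z∉ = AtomAt-tail (λ z∈ → z∉ (subst (_ ∈_) (namesL-side b A) z∈))

    cross : ∀ b {m γ} → m ∈ namesL A → AtomAt (side b A ∷ Γ) m γ →
            AtomAt (side (not b) A ∷ Γ) m (bar γ)
    cross b {m} m∈ q =
      let δ , p = ∈-namesL⇒⊑ (side b A) (subst (_ ∈_) (sym (namesL-side b A)) m∈) in
      here (subst (λ t → at (bar t) m ⊑ side (not b) A)
                  (AtomAt-functional (sf b) (here p) q) (⊑-side-flip b p))

    walk : ∀ {X b zs u γ} mid {y} → Alt G H (names A) X b zs → zs ≡ u ∷ mid ++ y ∷ [] →
           All (names A) mid → ¬ names A y → AtomAt (side b A ∷ Γ) u γ → AtomAt Γ y (bar γ)
    walk {b = b} [] (alt-one (Y , r , _)) refl _ y∉ q =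
      tail-side b y∉ (DualAt-step (sf b) (dual b (Y , r)) q)
    walk [] (alt-step _ ()) refl _ _ _
    walk (m ∷ mid) (alt-one _) eq _ _ _ =
      ⊥-elim (nonempty (++-conicalʳ mid _ (sym (∷-injectiveʳ (∷-injectiveʳ eq)))))
      where
      nonempty : ∀ {y : Name} → ¬ [ y ] ≡ []
      nonempty ()
    walk {b = b} {γ = γ} (m ∷ mid) {y} (alt-step (Y , r , _) alt) refl (m∈ ∷ mid∈) y∉ q =
      subst (AtomAt Γ y) (bar-invol (bar γ))
            (walk mid alt refl mid∈ y∉ (cross b m∈ (DualAt-step (sf b) (dual b (Y , r)) q)))

    alternating-path-dual : ∀ b {X x y} mid → Alt G H (names A) X b (x ∷ mid ++ y ∷ []) →
                            All (names A) mid → ¬ names A x → ¬ names A y → DualAt Γ x y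
    alternating-path-dual b mid alt mid∈ x∉ y∉ =
      let _ , e = Alt-head-edge alt ; α , p , _ = dual b e in
      α , tail-side b x∉ p , walk mid alt refl mid∈ y∉ p

    complete-path-dual : ∀ {X x y} → CompletePath G H (names A) X x y → DualAt Γ x y
    complete-path-dual (mid , _ , _ , mid∈ , x∉ , y∉ , inj₁ alt) =
      alternating-path-dual true mid alt mid∈ x∉ y∉
    complete-path-dual (mid , _ , _ , mid∈ , x∉ , y∉ , inj₂ alt) =
      alternating-path-dual false mid alt mid∈ x∉ y∉

  compose-edge-dual : ∀ {A Γ G H x y} → SharingFree (A ∷ Γ) → SharingFree (neg A ∷ Γ) →
                      (∀ {u v} → Edge G u v → DualAt (A ∷ Γ) u v) →
                      (∀ {u v} → Edge H u v → DualAt (neg A ∷ Γ) u v) →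
                      Edge (compose G (names A) H) x y → DualAt Γ x y
  compose-edge-dual {A} {Γ} {G} {H} sfG sfH dualG dualH
                    (_ , _ , _ , _ , _ , path) = complete-path-dual path
    where
    sf : ∀ b → SharingFree (side b A ∷ Γ)
    sf true  = sfG
    sf false = sfH
    dual : ∀ b {u v} → Edge (if' b G H) u v → DualAt (side b A ∷ Γ) u v
    dual true  = dualG
    dual false = dualH
    open CutPath sf dual

  Deriv-sharingFree : ∀ {Δ} → Deriv Δ → SharingFree Δ
  Deriv-sharingFree (ax _ _ _ _ sf _)    = sf
  Deriv-sharingFree (cut _ _ _ _ sf _)   = sf
  Deriv-sharingFree (sup _ _ sf)         = sf
  Deriv-sharingFree (or _ _ _ _ sf _)    = sf
  Deriv-sharingFree (and _ _ _ _ _ sf _) = sf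

  edge-dual : ∀ {Δ x y} (P : Deriv Δ) → Edge ⟪ P ⟫ x y → DualAt Δ x y
  edge-dual (ax Γ A B e _ π) (_ , Y , _ , r , _) =
    DualAt-map (↭⇒≼ π ∘ Anyₚ.++⁺ˡ) (idPair-edge-dual (erase-complementary A B e) (Y , r))
  edge-dual (cut Γ A Q R _ π) e =
    DualAt-map (↭⇒≼ π)
      (compose-edge-dual (Deriv-sharingFree Q) (Deriv-sharingFree R) (edge-dual Q) (edge-dual R) e)
  edge-dual (sup Q R _) (X , inj₁ r) = edge-dual Q (X , r)
  edge-dual (sup Q R _) (X , inj₂ r) = edge-dual R (X , r)
  edge-dual (or Γ A B Q _ π) e       = DualAt-map (↭⇒≼ π ∘ ∨-≼) (edge-dual Q e)
  edge-dual (and Γ A B Q R _ π) (X , inj₁ r) =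
    DualAt-map (↭⇒≼ π ∘ ∷⁺ ⊑-∧l id) (edge-dual Q (X , r))
  edge-dual (and Γ A B Q R _ π) (X , inj₂ r) =
    DualAt-map (↭⇒≼ π ∘ ∷⁺ ⊑-∧r id) (edge-dual R (X , r))

lemma13 : (𝔸 : AtomSet) → let open GS4 𝔸 in
    ∀ {Γ : List Fm} (P : Deriv Γ) (x y : Name) → Edge ⟪ P ⟫ x y →
    Σ Atom λ α → Σ Atom λ β → AtomAt Γ x α × AtomAt Γ y β × (α ≡ bar β)
lemma13 𝔸 P x y e =
  let open AtomSet 𝔸
      α , p , q = edge-dual 𝔸 P e
  in  α , bar α , p , q , sym (bar-invol α)
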